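{- Let $X$ be a super $X$-set parameter and let $G$ be a graph. If $S$ is a cut-vertex of $\mathfrak{X}(G)$, then $S=V(G)$.
   Context: All graphs are finite, simple, undirected, with nonempty vertex set. A vertex set property assigns to each graph $G$ a family of subsets of $V(G)$ (the $X$-sets of $G$), invariant under graph isomorphism; it is cohesive if every graph has at least one $X$-set. A super $X$-set parameter is a cohesive vertex set property such that if $S$ is an $X$-set of $G$ and $S\subseteq S'\subseteq V(G)$ then $S'$ is an $X$-set. The $X$-TAR graph $\mathfrak{X}(G)$ has as vertices the $X$-sets of $G$, with $S_1,S_2$ adjacent iff $|S_1\ominus S_2|=1$. -}

module Defs where

open import Data.Nat using (ℕ; suc)
open import Data.Bool using (Bool; true; false; _xor_)
open import Data.Fin using (Fin)
open import Data.Fin.Subset using (Subset; _⊆_; ∣_∣)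
open import Data.Fin.Permutation using (Permutation′; _⟨$⟩ʳ_; _⟨$⟩ˡ_)
open import Data.Vec using (zipWith; tabulate; lookup)
open import Data.Product using (_×_)
import Data.Product
import Data.Unit
open import Relation.Binary.PropositionalEquality using (_≡_; _≢_)
open import Relation.Nullary using (¬_)

-- A finite simple undirected graph on the vertex set Fin m.
-- (Nonemptiness is imposed by always using m = suc n.)
record Graph (m : ℕ) : Set where
  field
    adj     : Fin m → Fin m → Bool
    adj-sym : ∀ i j → adj i j ≡ adj j i
    irrefl  : ∀ i → adj i i ≡ false
open Graph public

IsIso : ∀ {m} → Permutation′ m → Graph m → Graph m → Set
IsIso σ G H = ∀ i j → adj G i j ≡ adj H (σ ⟨$⟩ʳ i) (σ ⟨$⟩ʳ j)

image : ∀ {m} → Permutation′ m → Subset m → Subset m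
image σ S = tabulate (λ k → lookup S (σ ⟨$⟩ˡ k))

record VertexSetProperty : Set₁ where
  field
    isX       : ∀ {n} → Graph (suc n) → Subset (suc n) → Set
    invariant : ∀ {n} (G H : Graph (suc n)) (σ : Permutation′ (suc n)) →
                IsIso σ G H → ∀ S → isX G S → isX H (image σ S)
open VertexSetProperty public

Cohesive : VertexSetProperty → Set
Cohesive X = ∀ {n} (G : Graph (suc n)) → Data.Product.∃ (λ S → isX X G S)

SupersetClosed : VertexSetProperty → Set
SupersetClosed X = ∀ {n} (G : Graph (suc n)) (S S′ : Subset (suc n)) →
                   isX X G S → S ⊆ S′ → isX X G S′

SuperXSetParameter : VertexSetProperty → Set
SuperXSetParameter X = Cohesive X × SupersetClosed X

_⊖_ : ∀ {m} → Subset m → Subset m → Subset m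
S ⊖ T = zipWith _xor_ S T

-- adjacency in the X-TAR graph 𝔛(G) (vertices: X-sets of G)
TARAdj : ∀ {m} → Subset m → Subset m → Set
TARAdj S T = ∣ S ⊖ T ∣ ≡ 1

-- Walks in 𝔛(G) whose vertices all satisfy the extra constraint Allowed
-- (used to express walks in 𝔛(G) and in 𝔛(G) − S).
data Walk {n} (X : VertexSetProperty) (G : Graph (suc n))
          (Allowed : Subset (suc n) → Set) :
          Subset (suc n) → Subset (suc n) → Set where
  here : ∀ {A} → isX X G A → Allowed A → Walk X G Allowed A A
  step : ∀ {A B C} → isX X G A → Allowed A → TARAdj A B →
         Walk X G Allowed B C → Walk X G Allowed A C

-- S is a cut-vertex of 𝔛(G): S is a vertex of 𝔛(G), and there are two other
-- vertices of 𝔛(G) lying in the same component of 𝔛(G) that lie in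
-- different components of 𝔛(G) − S (i.e. deleting S increases the number of
-- components).
IsCutVertexTAR : ∀ {n} → VertexSetProperty → Graph (suc n) → Subset (suc n) → Set
IsCutVertexTAR X G S =
  isX X G S ×
  Data.Product.∃ (λ A → Data.Product.∃ (λ B →
    A ≢ S × B ≢ S ×
    Walk X G (λ _ → Data.Unit.⊤) A B ×
    ¬ Walk X G (λ T → T ≢ S) A B))

-- If some vertex x lies outside S, then every X-set T ≠ S is joined to V(G) in 𝔛(G) − S:
-- first insert x (one step, allowed since T ≠ S), then insert the remaining vertices one at a
-- time. Superset closure keeps every set on the way an X-set, and all of them contain x, so
-- none equals S. Thus the two X-sets separated by S would be connected through V(G).
module Submission where

open import Defs
open import Data.Nat using (ℕ; zero; suc)
open import Data.Bool using (true; false)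
open import Data.Bool.Properties using (xor-comm)
open import Data.Fin using (Fin)
open import Data.Fin.Subset using (Subset; _∈_; _∉_; _⊆_; ⊤; inside; ∣_∣)
open import Data.Fin.Subset.Properties using (_∈?_; ⊆⊤; ⊆-antisym)
open import Data.Vec using ([]; _∷_; here; there; _[_]≔_)
open import Data.Vec.Properties using (zipWith-comm; []≔-updates)
open import Data.Product using (_,_)
open import Data.Sum using (_⊎_; inj₁; inj₂; map₁)
open import Relation.Binary.PropositionalEquality using (_≡_; _≢_; refl; cong; subst)
open import Relation.Nullary.Decidable using (decidable-stable)

⊖-comm : ∀ {m} (p q : Subset m) → p ⊖ q ≡ q ⊖ p
⊖-comm = zipWith-comm xor-comm

TARAdj-sym : ∀ {m} {p q : Subset m} → TARAdj p q → TARAdj q p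
TARAdj-sym {p = p} {q} = subst (λ r → ∣ r ∣ ≡ 1) (⊖-comm p q)

∣p⊖p∣≡0 : ∀ {m} (p : Subset m) → ∣ p ⊖ p ∣ ≡ 0
∣p⊖p∣≡0 []          = refl
∣p⊖p∣≡0 (true ∷ p)  = ∣p⊖p∣≡0 p
∣p⊖p∣≡0 (false ∷ p) = ∣p⊖p∣≡0 p

TARAdj⁼ : ∀ {m} → Subset m → Subset m → Set
TARAdj⁼ p q = p ≡ q ⊎ TARAdj p q

UpwardClosed : ∀ {m} → (Subset m → Set) → Set
UpwardClosed P = ∀ {p q} → P p → p ⊆ q → P q

module _ {n} {X : VertexSetProperty} {G : Graph (suc n)} where

  isX-source : ∀ {Al A B} → Walk X G Al A B → isX X G A
  isX-source (here xA _)     = xA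
  isX-source (step xA _ _ _) = xA

  isX-target : ∀ {Al A B} → Walk X G Al A B → isX X G B
  isX-target (here xB _)    = xB
  isX-target (step _ _ _ w) = isX-target w

  allowed-target : ∀ {Al A B} → Walk X G Al A B → Al B
  allowed-target (here _ alB)   = alB
  allowed-target (step _ _ _ w) = allowed-target w

  weaken : ∀ {Al Al′ A B} → (∀ {T} → Al T → Al′ T) → Walk X G Al A B → Walk X G Al′ A B
  weaken f (here xA alA)     = here xA (f alA)
  weaken f (step xA alA a w) = step xA (f alA) a (weaken f w)

  module _ {Al : Subset (suc n) → Set} where

    _++_ : ∀ {A B C} → Walk X G Al A B → Walk X G Al B C → Walk X G Al A C
    here _ _        ++ w′ = w′
    step xA alA a w ++ w′ = step xA alA a (w ++ w′)

    cons⁼ : ∀ {A B C} → isX X G A → Al A → TARAdj⁼ A B → Walk X G Al B C → Walk X G Al A C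
    cons⁼ _  _   (inj₁ refl) w = w
    cons⁼ xA alA (inj₂ a)    w = step xA alA a w

    snoc⁼ : ∀ {A B C} → Walk X G Al A B → isX X G C → Al C → TARAdj⁼ B C → Walk X G Al A C
    snoc⁼ w xC alC (inj₁ refl) = w
    snoc⁼ w xC alC (inj₂ a)    = w ++ step (isX-target w) (allowed-target w) a (here xC alC)

    reverse : ∀ {A B} → Walk X G Al A B → Walk X G Al B A
    reverse (here xA alA)             = here xA alA
    reverse (step {A} {B} xA alA a w) = snoc⁼ (reverse w) xA alA (inj₂ (TARAdj-sym {p = A} {B} a))

fillPrefix : ∀ {m} → ℕ → Subset m → Subset m
fillPrefix zero    p       = p
fillPrefix (suc k) []      = []
fillPrefix (suc k) (_ ∷ p) = inside ∷ fillPrefix k p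

fillPrefix-step : ∀ {m} k (p : Subset m) → TARAdj⁼ (fillPrefix k p) (fillPrefix (suc k) p)
fillPrefix-step zero    []          = inj₁ refl
fillPrefix-step zero    (true ∷ p)  = inj₁ refl
fillPrefix-step zero    (false ∷ p) = inj₂ (cong suc (∣p⊖p∣≡0 p))
fillPrefix-step (suc k) []          = inj₁ refl
fillPrefix-step (suc k) (_ ∷ p)     = map₁ (cong (inside ∷_)) (fillPrefix-step k p)

fillPrefix-full : ∀ {m} (p : Subset m) → fillPrefix m p ≡ ⊤
fillPrefix-full []      = refl
fillPrefix-full (_ ∷ p) = cong (inside ∷_) (fillPrefix-full p)

⊆-fillPrefix : ∀ {m} k (p : Subset m) → p ⊆ fillPrefix k p
⊆-fillPrefix zero    p       x∈p         = x∈p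
⊆-fillPrefix (suc k) (_ ∷ p) here        = here
⊆-fillPrefix (suc k) (_ ∷ p) (there x∈p) = there (⊆-fillPrefix k p x∈p)

insert-step : ∀ {m} (x : Fin m) (p : Subset m) → TARAdj⁼ p (p [ x ]≔ inside)
insert-step Fin.zero    (true ∷ p)  = inj₁ refl
insert-step Fin.zero    (false ∷ p) = inj₂ (cong suc (∣p⊖p∣≡0 p))
insert-step (Fin.suc x) (true ∷ p)  = map₁ (cong (inside ∷_)) (insert-step x p)
insert-step (Fin.suc x) (false ∷ p) = map₁ (cong (false ∷_)) (insert-step x p)

⊆-insert : ∀ {m} (x : Fin m) (p : Subset m) → p ⊆ p [ x ]≔ inside
⊆-insert Fin.zero    (_ ∷ p) here        = here
⊆-insert Fin.zero    (_ ∷ p) (there y∈p) = there y∈p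
⊆-insert (Fin.suc x) (_ ∷ p) here        = here
⊆-insert (Fin.suc x) (_ ∷ p) (there y∈p) = there (⊆-insert x p y∈p)

module _ {n} {X : VertexSetProperty} (sup : SupersetClosed X) (G : Graph (suc n)) where

  walk-to-⊤ : ∀ {Al T} → UpwardClosed Al → isX X G T → Al T → Walk X G Al T ⊤
  walk-to-⊤ {Al} {T} up xT alT = subst (Walk X G Al T) (fillPrefix-full T) (walk-fillPrefix (suc n))
    where
    walk-fillPrefix : ∀ k → Walk X G Al T (fillPrefix k T)
    walk-fillPrefix zero    = here xT alT
    walk-fillPrefix (suc k) =
      snoc⁼ (walk-fillPrefix k) (sup G T _ xT (⊆-fillPrefix (suc k) T))
            (up alT (⊆-fillPrefix (suc k) T)) (fillPrefix-step k T)

  walk-to-⊤-avoiding : ∀ {x S T} → x ∉ S → isX X G T → T ≢ S → Walk X G (_≢ S) T ⊤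
  walk-to-⊤-avoiding {x} {S} {T} x∉S xT T≢S =
    cons⁼ xT T≢S (insert-step x T) (weaken avoids-S walk-through-x)
    where
    avoids-S : ∀ {U} → x ∈ U → U ≢ S
    avoids-S x∈U U≡S = x∉S (subst (x ∈_) U≡S x∈U)

    walk-through-x : Walk X G (x ∈_) (T [ x ]≔ inside) ⊤
    walk-through-x = walk-to-⊤ (λ x∈p p⊆q → p⊆q x∈p)
                       (sup G T _ xT (⊆-insert x T)) ([]≔-updates T x)

proposition2p46 : (X : VertexSetProperty) → SuperXSetParameter X →
    ∀ {n} (G : Graph (suc n)) (S : Subset (suc n)) →
    IsCutVertexTAR X G S → S ≡ ⊤
proposition2p46 X (_ , sup) G S (_ , A , B , A≢S , B≢S , A⇝B , ¬A⇝B-avoiding-S) =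
  ⊆-antisym ⊆⊤ λ {x} _ → decidable-stable (x ∈? S) λ x∉S →
    ¬A⇝B-avoiding-S (walk-to-⊤-avoiding sup G x∉S (isX-source A⇝B) A≢S
                     ++ reverse (walk-to-⊤-avoiding sup G x∉S (isX-target A⇝B) B≢S))
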